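{- Let $a,b\ge 2$ be integers and $n\ge 8$. Let $r=a$, $s=b$ if $n$ is even and $r=b$, $s=a$ if $n$ is odd, and suppose both $r$ and $s$ are odd. Then $$f_{(a,b,n)} = \left[ \left(f_{(a,b,n-2)}^2\right)^{(s+1)/2} t_{(a,b,n-3)} \left(f_{(a,b,n-2)}^2\right)^{(s-1)/2} f_{(a,b,n-3)}\right]^{(r-1)/2} \left(f_{(a,b,n-2)}^2\right)^{(s+1)/2} t_{(a,b,n-3)}.$$
   Context: Words are over the alphabet $\{0,1\}$, with concatenation as the product; $w^k$ denotes the concatenation of $k$ copies of $w$ ($w^0$ is the empty word). For integers $a,b\ge 1$ the biperiodic Fibonacci words are defined by $f_{(a,b,0)}=0$, $f_{(a,b,1)}=0^{a-1}1$, and for $n\ge 2$: $f_{(a,b,n)} = f_{(a,b,n-1)}^{a}f_{(a,b,n-2)}$ if $n$ is even, and $f_{(a,b,n)} = f_{(a,b,n-1)}^{b}f_{(a,b,n-2)}$ if $n$ is odd. For a word $f_{(a,b,n)}$ with at least two letters, write $f_{(a,b,n)} = p\,xy$ with $x,y$ letters; then $t_{(a,b,n)} := p\,yx$ is $f_{(a,b,n)}$ with its last two letters interchanged. -}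

module Defs where

open import Data.Nat using (ℕ; zero; suc; _+_; _*_; _∸_)
open import Data.List using (List; []; _∷_; _++_)
open import Data.Bool using (Bool; true; false; if_then_else_)
open import Data.Nat using (_≡ᵇ_)
open import Data.Nat.DivMod using (_%_)

data Bit : Set where
  𝟎 𝟏 : Bit

Word : Set
Word = List Bit

_^ʷ_ : Word → ℕ → Word
w ^ʷ zero  = []
w ^ʷ suc k = w ++ (w ^ʷ k)

isEven : ℕ → Bool
isEven zero = true
isEven (suc zero) = false
isEven (suc (suc n)) = isEven n

fib : ℕ → ℕ → ℕ → Word
fib a b zero = 𝟎 ∷ []
fib a b (suc zero) = (𝟎 ∷ []) ^ʷ (a ∸ 1) ++ (𝟏 ∷ [])
fib a b (suc (suc n)) =
  (if isEven n then fib a b (suc n) ^ʷ a else fib a b (suc n) ^ʷ b) ++ fib a b n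

-- interchange the last two letters (identity on words of length < 2,
-- which never arises in the theorem)
swapLast2 : Word → Word
swapLast2 [] = []
swapLast2 (x ∷ []) = x ∷ []
swapLast2 (x ∷ y ∷ []) = y ∷ x ∷ []
swapLast2 (x ∷ y ∷ z ∷ w) = x ∷ swapLast2 (y ∷ z ∷ w)

tw : ℕ → ℕ → ℕ → Word
tw a b n = swapLast2 (fib a b n)

-- Write F = f_(m+1), G = f_m and T = t_m, so that f_(m+3) = (F^s G)^r F.  The words f_k f_(k+1) and
-- f_(k+1) f_k differ exactly by an interchange of their last two letters, hence
-- G F = F T.  With s = 2j+1 the block A = F^s G satisfies A F = (F F)^(j+1) T and
-- A A = (F F)^(j+1) T (F F)^j G, and with r = 2k+1 we get A^r F = (A A)^k (A F).
module Submission where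

open import Defs
open import Data.Nat using (ℕ; _+_; _∸_; _≥_; _/_)
open import Data.Nat.Divisibility using (_∣_)
open import Data.List using (_++_)
open import Data.Bool using (if_then_else_)
open import Relation.Nullary using (¬_)
open import Relation.Binary.PropositionalEquality using (_≡_)

open import Data.Nat using (zero; suc; _*_; _≤_; s≤s; z≤n)
open import Data.Nat.Properties using (+-comm; +-mono-≤; m≤m+n; m≤n+m; ≤-trans)
open import Data.Nat.DivMod using (m*n/n≡m)
open import Data.Nat.Divisibility using (_∣0; ∣-refl; ∣m∣n⇒∣m+n)
open import Data.List using (List; []; _∷_; length)
open import Data.List.Properties using (++-assoc; ++-identityʳ; length-++)
open import Data.Bool using (true; false)
open import Data.Product using (∃-syntax; _,_)
open import Data.Empty using (⊥-elim)
open import Function using (_∘_)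
open import Algebra.Definitions using (Involutive)
open import Relation.Binary.PropositionalEquality
  using (refl; sym; trans; cong; cong₂; subst; module ≡-Reasoning)

open ≡-Reasoning

^ʷ-suc-right : ∀ (w : Word) n → w ^ʷ suc n ≡ w ^ʷ n ++ w
^ʷ-suc-right w zero    = ++-identityʳ w
^ʷ-suc-right w (suc n) = begin
  w ++ w ^ʷ suc n    ≡⟨ cong (w ++_) (^ʷ-suc-right w n) ⟩
  w ++ (w ^ʷ n ++ w) ≡⟨ ++-assoc w (w ^ʷ n) w ⟨
  w ^ʷ suc n ++ w    ∎

^ʷ-square : ∀ (w : Word) n → (w ++ w) ^ʷ n ≡ w ^ʷ (n * 2)
^ʷ-square w zero    = refl
^ʷ-square w (suc n) = begin
  (w ++ w) ++ (w ++ w) ^ʷ n ≡⟨ ++-assoc w w _ ⟩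
  w ++ w ++ (w ++ w) ^ʷ n   ≡⟨ cong (λ u → w ++ w ++ u) (^ʷ-square w n) ⟩
  w ++ w ++ w ^ʷ (n * 2)    ∎

^ʷ-odd-++ : ∀ (A F : Word) k → A ^ʷ suc (k * 2) ++ F ≡ (A ++ A) ^ʷ k ++ A ++ F
^ʷ-odd-++ A F k = begin
  A ^ʷ suc (k * 2) ++ F     ≡⟨ cong (_++ F) (^ʷ-suc-right A (k * 2)) ⟩
  (A ^ʷ (k * 2) ++ A) ++ F  ≡⟨ ++-assoc (A ^ʷ (k * 2)) A F ⟩
  A ^ʷ (k * 2) ++ A ++ F    ≡⟨ cong (_++ A ++ F) (^ʷ-square A k) ⟨
  (A ++ A) ^ʷ k ++ A ++ F   ∎

suc-double-power-factorisation : ∀ (F G T : Word) j k → G ++ F ≡ F ++ T →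
  (F ^ʷ suc (j * 2) ++ G) ^ʷ suc (k * 2) ++ F ≡
  ((F ++ F) ^ʷ suc j ++ T ++ (F ++ F) ^ʷ j ++ G) ^ʷ k ++ (F ++ F) ^ʷ suc j ++ T
suc-double-power-factorisation F G T j k GF≡FT = begin
  A ^ʷ suc (k * 2) ++ F    ≡⟨ ^ʷ-odd-++ A F k ⟩
  (A ++ A) ^ʷ k ++ A ++ F  ≡⟨ cong₂ (λ u v → u ^ʷ k ++ v) AA≡ AF≡ ⟩
  _                        ∎
  where
  Fˢ = F ^ʷ suc (j * 2)
  A  = Fˢ ++ G
  Fˢ++F : Fˢ ++ F ≡ (F ++ F) ^ʷ suc j
  Fˢ++F = trans (sym (^ʷ-suc-right F (suc (j * 2)))) (sym (^ʷ-square F (suc j)))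
  AF≡ : A ++ F ≡ (F ++ F) ^ʷ suc j ++ T
  AF≡ = begin
    (Fˢ ++ G) ++ F  ≡⟨ ++-assoc Fˢ G F ⟩
    Fˢ ++ G ++ F    ≡⟨ cong (Fˢ ++_) GF≡FT ⟩
    Fˢ ++ F ++ T    ≡⟨ ++-assoc Fˢ F T ⟨
    (Fˢ ++ F) ++ T  ≡⟨ cong (_++ T) Fˢ++F ⟩
    (F ++ F) ^ʷ suc j ++ T ∎
  AA≡ : A ++ A ≡ (F ++ F) ^ʷ suc j ++ T ++ (F ++ F) ^ʷ j ++ G
  AA≡ = begin
    (Fˢ ++ G) ++ Fˢ ++ G         ≡⟨ ++-assoc Fˢ G (Fˢ ++ G) ⟩
    Fˢ ++ G ++ Fˢ ++ G           ≡⟨ cong (Fˢ ++_) (++-assoc G Fˢ G) ⟨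
    Fˢ ++ (G ++ F ++ F ^ʷ (j * 2)) ++ G
      ≡⟨ cong (λ u → Fˢ ++ u ++ G) (++-assoc G F (F ^ʷ (j * 2))) ⟨
    Fˢ ++ ((G ++ F) ++ F ^ʷ (j * 2)) ++ G
      ≡⟨ cong (λ u → Fˢ ++ (u ++ F ^ʷ (j * 2)) ++ G) GF≡FT ⟩
    Fˢ ++ ((F ++ T) ++ F ^ʷ (j * 2)) ++ G
      ≡⟨ cong (λ u → Fˢ ++ u ++ G) (++-assoc F T (F ^ʷ (j * 2))) ⟩
    Fˢ ++ (F ++ T ++ F ^ʷ (j * 2)) ++ G
      ≡⟨ cong (Fˢ ++_) (++-assoc F (T ++ F ^ʷ (j * 2)) G) ⟩
    Fˢ ++ F ++ (T ++ F ^ʷ (j * 2)) ++ G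
      ≡⟨ ++-assoc Fˢ F _ ⟨
    (Fˢ ++ F) ++ (T ++ F ^ʷ (j * 2)) ++ G
      ≡⟨ cong₂ _++_ Fˢ++F (++-assoc T (F ^ʷ (j * 2)) G) ⟩
    (F ++ F) ^ʷ suc j ++ T ++ F ^ʷ (j * 2) ++ G
      ≡⟨ cong (λ u → (F ++ F) ^ʷ suc j ++ T ++ u ++ G) (^ʷ-square F j) ⟨
    (F ++ F) ^ʷ suc j ++ T ++ (F ++ F) ^ʷ j ++ G ∎

odd⇒suc-double : ∀ {s} → ¬ (2 ∣ s) → ∃[ j ] s ≡ suc (j * 2)
odd⇒suc-double {zero}        s-odd = ⊥-elim (s-odd (2 ∣0))
odd⇒suc-double {suc zero}    s-odd = 0 , refl
odd⇒suc-double {suc (suc s)} s-odd with odd⇒suc-double (s-odd ∘ ∣m∣n⇒∣m+n ∣-refl)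
... | j , refl = suc j , refl

pred-half : ∀ j → (suc (j * 2) ∸ 1) / 2 ≡ j
pred-half j = m*n/n≡m j 2

suc-half : ∀ j → (suc (j * 2) + 1) / 2 ≡ suc j
suc-half j = trans (cong (_/ 2) (+-comm (suc (j * 2)) 1)) (m*n/n≡m (suc j) 2)

odd-power-factorisation : ∀ (F G T : Word) r s → G ++ F ≡ F ++ T → ¬ (2 ∣ r) → ¬ (2 ∣ s) →
  (F ^ʷ s ++ G) ^ʷ r ++ F ≡
  ((F ++ F) ^ʷ ((s + 1) / 2) ++ T ++ (F ++ F) ^ʷ ((s ∸ 1) / 2) ++ G) ^ʷ ((r ∸ 1) / 2)
    ++ (F ++ F) ^ʷ ((s + 1) / 2) ++ T
odd-power-factorisation F G T r s GF≡FT r-odd s-odd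
  with odd⇒suc-double r-odd | odd⇒suc-double s-odd
... | k , refl | j , refl
  rewrite pred-half k | pred-half j | suc-half j =
  suc-double-power-factorisation F G T j k GF≡FT

swapLast2-∷ : ∀ x {w} → 2 ≤ length w → swapLast2 (x ∷ w) ≡ x ∷ swapLast2 w
swapLast2-∷ x {_ ∷ []}    (s≤s ())
swapLast2-∷ x {_ ∷ _ ∷ _} _ = refl

≤-length-++ʳ : ∀ {A : Set} (xs ys : List A) → length ys ≤ length (xs ++ ys)
≤-length-++ʳ xs ys = subst (length ys ≤_) (sym (length-++ xs)) (m≤n+m _ _)

swapLast2-++ : ∀ xs {ys} → 2 ≤ length ys → swapLast2 (xs ++ ys) ≡ xs ++ swapLast2 ys
swapLast2-++ []       _  = refl
swapLast2-++ (x ∷ xs) {ys} 2≤ys = trans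
  (swapLast2-∷ x (≤-trans 2≤ys (≤-length-++ʳ xs ys)))
  (cong (x ∷_) (swapLast2-++ xs 2≤ys))

length-swapLast2 : ∀ w → length (swapLast2 w) ≡ length w
length-swapLast2 []              = refl
length-swapLast2 (_ ∷ [])        = refl
length-swapLast2 (_ ∷ _ ∷ [])    = refl
length-swapLast2 (_ ∷ y ∷ z ∷ w) = cong suc (length-swapLast2 (y ∷ z ∷ w))

swapLast2-involutive : Involutive _≡_ swapLast2
swapLast2-involutive []              = refl
swapLast2-involutive (_ ∷ [])        = refl
swapLast2-involutive (_ ∷ _ ∷ [])    = refl
swapLast2-involutive (x ∷ y ∷ z ∷ w) = trans
  (swapLast2-∷ x (subst (2 ≤_) (sym (length-swapLast2 (y ∷ z ∷ w))) (s≤s (s≤s z≤n))))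
  (cong (x ∷_) (swapLast2-involutive (y ∷ z ∷ w)))

fibExponent : ℕ → ℕ → ℕ → ℕ
fibExponent a b n = if isEven n then a else b

fibExponent-suc : ∀ a b n → fibExponent a b (suc n) ≡ (if isEven n then b else a)
fibExponent-suc a b zero          = refl
fibExponent-suc a b (suc zero)    = refl
fibExponent-suc a b (suc (suc n)) = fibExponent-suc a b n

fib-suc-suc : ∀ a b k → fib a b (suc (suc k)) ≡ fib a b (suc k) ^ʷ fibExponent a b k ++ fib a b k
fib-suc-suc a b k with isEven k
... | true  = refl
... | false = refl

length-fib-≥1 : ∀ a b k → 1 ≤ length (fib a b k)
length-fib-≥1 a b zero          = s≤s z≤n
length-fib-≥1 a b (suc zero)    = ≤-length-++ʳ ((𝟎 ∷ []) ^ʷ (a ∸ 1)) (𝟏 ∷ [])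
length-fib-≥1 a b (suc (suc k)) = subst (λ w → 1 ≤ length w) (sym (fib-suc-suc a b k))
  (≤-trans (length-fib-≥1 a b k) (≤-length-++ʳ (fib a b (suc k) ^ʷ fibExponent a b k) (fib a b k)))

length-fib-≥2 : ∀ {a b} k → 1 ≤ a → 1 ≤ b → 2 ≤ length (fib a b (suc (suc k)))
length-fib-≥2 {a} {b} k a≥1 b≥1 =
  subst (λ w → 2 ≤ length w) (sym (fib-suc-suc a b k))
    (subst (2 ≤_) (sym (length-++ (F ^ʷ fibExponent a b k)))
      (+-mono-≤ (length-power (fibExponent a b k) exponent≥1) (length-fib-≥1 a b k)))
  where
  F = fib a b (suc k)
  exponent≥1 : 1 ≤ fibExponent a b k
  exponent≥1 with isEven k
  ... | true  = a≥1
  ... | false = b≥1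
  length-power : ∀ c → 1 ≤ c → 1 ≤ length (F ^ʷ c)
  length-power (suc c) _ = ≤-trans (length-fib-≥1 a b (suc k))
    (subst (length F ≤_) (sym (length-++ F)) (m≤m+n _ _))

swapLast2-fib-suc-++-fib : ∀ a b k → swapLast2 (fib a b (suc k) ++ fib a b k) ≡ fib a b k ++ fib a b (suc k)
swapLast2-fib-suc-++-fib a b zero = begin
  swapLast2 ((Z ++ 𝟏 ∷ []) ++ 𝟎 ∷ [])  ≡⟨ cong swapLast2 (++-assoc Z (𝟏 ∷ []) (𝟎 ∷ [])) ⟩
  swapLast2 (Z ++ 𝟏 ∷ 𝟎 ∷ [])          ≡⟨ swapLast2-++ Z (s≤s (s≤s z≤n)) ⟩
  Z ++ 𝟎 ∷ 𝟏 ∷ []                       ≡⟨ ++-assoc Z (𝟎 ∷ []) (𝟏 ∷ []) ⟨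
  (Z ++ 𝟎 ∷ []) ++ 𝟏 ∷ []               ≡⟨ cong (_++ 𝟏 ∷ []) (^ʷ-suc-right (𝟎 ∷ []) (a ∸ 1)) ⟨
  𝟎 ∷ Z ++ 𝟏 ∷ []                       ∎
  where Z = (𝟎 ∷ []) ^ʷ (a ∸ 1)
swapLast2-fib-suc-++-fib a b (suc k) = begin
  swapLast2 (fib a b (suc (suc k)) ++ F)  ≡⟨ cong (λ u → swapLast2 (u ++ F)) (fib-suc-suc a b k) ⟩
  swapLast2 ((P ++ G) ++ F)               ≡⟨ cong swapLast2 (++-assoc P G F) ⟩
  swapLast2 (P ++ G ++ F)                 ≡⟨ swapLast2-++ P 2≤GF ⟩
  P ++ swapLast2 (G ++ F)                 ≡⟨ cong (λ u → P ++ swapLast2 u) (swapLast2-fib-suc-++-fib a b k) ⟨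
  P ++ swapLast2 (swapLast2 (F ++ G))     ≡⟨ cong (P ++_) (swapLast2-involutive (F ++ G)) ⟩
  P ++ F ++ G                             ≡⟨ ++-assoc P F G ⟨
  (P ++ F) ++ G                           ≡⟨ cong (_++ G) (^ʷ-suc-right F e) ⟨
  (F ++ P) ++ G                           ≡⟨ ++-assoc F P G ⟩
  F ++ P ++ G                             ≡⟨ cong (F ++_) (fib-suc-suc a b k) ⟨
  F ++ fib a b (suc (suc k))              ∎
  where
  F = fib a b (suc k)
  G = fib a b k
  e = fibExponent a b k
  P = F ^ʷ e
  2≤GF : 2 ≤ length (G ++ F)
  2≤GF = subst (2 ≤_) (sym (length-++ G)) (+-mono-≤ (length-fib-≥1 a b k) (length-fib-≥1 a b (suc k)))

fib-++-fib-suc : ∀ a b k → 2 ≤ length (fib a b k) → fib a b k ++ fib a b (suc k) ≡ fib a b (suc k) ++ tw a b k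
fib-++-fib-suc a b k 2≤fib = trans
  (sym (swapLast2-fib-suc-++-fib a b k))
  (swapLast2-++ (fib a b (suc k)) 2≤fib)

mainTheorem6 : (a b n : ℕ) → a ≥ 2 → b ≥ 2 → n ≥ 8 →
  let r = if isEven n then a else b
      s = if isEven n then b else a
      F2 = fib a b (n ∸ 2) ++ fib a b (n ∸ 2)
  in ¬ (2 ∣ r) → ¬ (2 ∣ s) →
     fib a b n ≡
       ((F2 ^ʷ ((s + 1) / 2)) ++ tw a b (n ∸ 3) ++ (F2 ^ʷ ((s ∸ 1) / 2)) ++ fib a b (n ∸ 3)) ^ʷ ((r ∸ 1) / 2)
       ++ (F2 ^ʷ ((s + 1) / 2)) ++ tw a b (n ∸ 3)
mainTheorem6 a b n@(suc (suc (suc (suc (suc k))))) a≥2 b≥2 (s≤s (s≤s (s≤s (s≤s (s≤s _))))) r-odd s-odd = begin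
  fib a b n                                       ≡⟨ fib-suc-suc a b (suc m) ⟩
  fib a b (suc (suc m)) ^ʷ r ++ F                 ≡⟨ cong (λ u → u ^ʷ r ++ F) (fib-suc-suc a b m) ⟩
  (F ^ʷ fibExponent a b m ++ G) ^ʷ r ++ F         ≡⟨ cong (λ e → (F ^ʷ e ++ G) ^ʷ r ++ F) (fibExponent-suc a b (suc m)) ⟩
  (F ^ʷ s ++ G) ^ʷ r ++ F                         ≡⟨ odd-power-factorisation F G (tw a b m) r s GF≡FT r-odd s-odd ⟩
  _                                               ∎
  where
  m = suc (suc k)
  F = fib a b (suc m)
  G = fib a b m
  r = fibExponent a b n
  s = if isEven n then b else a
  GF≡FT : G ++ F ≡ F ++ tw a b m
  GF≡FT = fib-++-fib-suc a b m (length-fib-≥2 k (≤-trans (s≤s z≤n) a≥2) (≤-trans (s≤s z≤n) b≥2))
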